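{- Let $(f,M)$ be a polymatroid and $F_1,F_2$ flats of it. Let $\mathcal M=\mathcal M(F_1,F_2)$ be the modular cut generated by $F_1$ and $F_2$, and suppose $S=F_1\cap F_2\notin\mathcal M$ (so $\mathcal M$ is non-principal) and $\delta(\mathcal M)=\delta(F_1,F_2)$; write $\delta=\delta(F_1,F_2)$. Then for every $F\in\mathcal M$: (a) $S\subseteq F$; (b) $f(F)-f(S)>\delta$.
   Context: A polymatroid $(f,M)$: finite $M$, $f$ on subsets of $M$ with $f(\emptyset)=0$, non-negative, monotone, submodular. A flat is a subset $F\subseteq M$ such that every proper superset has strictly larger rank; intersections of flats are flats. Modular defect: $\delta(A,B)=f(A)+f(B)-f(A\cap B)-f(A\cup B)$; a modular pair has defect $0$. A modular cut is a collection $\mathcal M$ of flats that is closed upward among flats and such that whenever $F,G\in\mathcal M$ form a modular pair, $F\cap G\in\mathcal M$. It is principal if the intersection of all its elements lies in it. The modular cut generated by flats $F_1,F_2$, $\mathcal M(F_1,F_2)$, is the smallest modular cut containing both (the intersection of all modular cuts containing them). For a non-principal modular cut $\mathcal M$, $\delta(\mathcal M)$ is the minimum of $\delta(G_1,G_2)$ over pairs $G_1,G_2\in\mathcal M$ with $G_1\cap G_2\notin\mathcal M$. -}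

module Defs where

open import Level using (0ℓ)
open import Data.Nat using (ℕ)
open import Data.Product using (_×_; Σ-syntax)
open import Data.Fin.Subset using (Subset; _⊆_; _∩_; _∪_) renaming (⊥ to ∅)
open import Relation.Binary.PropositionalEquality using (_≡_; _≢_)
open import Relation.Binary.Structures using (IsTotalOrder)
open import Relation.Nullary using (¬_)
open import Algebra.Structures using (IsAbelianGroup)

-- Values of the rank function: a totally ordered abelian group
-- (the paper uses real numbers; ℝ is an instance of this structure).
record OrderedAbelianGroup : Set₁ where
  infixl 6 _+_ _-_
  infix 8 -_
  infix 4 _≤_ _<_
  field
    Carrier        : Set
    _+_            : Carrier → Carrier → Carrier
    0#             : Carrier
    -_             : Carrier → Carrier
    _≤_            : Carrier → Carrier → Set
    isAbelianGroup : IsAbelianGroup _≡_ _+_ 0# -_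
    isTotalOrder   : IsTotalOrder _≡_ _≤_
    +-monoˡ-≤      : ∀ {a b} c → a ≤ b → a + c ≤ b + c

  _-_ : Carrier → Carrier → Carrier
  a - b = a + (- b)

  _<_ : Carrier → Carrier → Set
  a < b = (a ≤ b) × (a ≢ b)

module _ (R : OrderedAbelianGroup) {n : ℕ} where
  open OrderedAbelianGroup R

  RankFn : Set
  RankFn = Subset n → Carrier

  record IsPolymatroid (f : RankFn) : Set where
    field
      f-∅         : f ∅ ≡ 0#
      nonneg      : ∀ A → 0# ≤ f A
      monotone    : ∀ {A B} → A ⊆ B → f A ≤ f B
      submodular  : ∀ A B → f (A ∪ B) + f (A ∩ B) ≤ f A + f B

  IsFlat : RankFn → Subset n → Set
  IsFlat f F = ∀ G → F ⊆ G → F ≢ G → f F < f G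

  defect : RankFn → Subset n → Subset n → Carrier
  defect f A B = f A + f B - f (A ∩ B) - f (A ∪ B)

  ModularPair : RankFn → Subset n → Subset n → Set
  ModularPair f A B = defect f A B ≡ 0#

  Collection : Set₁
  Collection = Subset n → Set

  record IsModularCut (f : RankFn) (𝓜 : Collection) : Set where
    field
      flats     : ∀ F → 𝓜 F → IsFlat f F
      upward    : ∀ F G → 𝓜 F → IsFlat f G → F ⊆ G → 𝓜 G
      modular   : ∀ F G → 𝓜 F → 𝓜 G → ModularPair f F G → 𝓜 (F ∩ G)

  GenCut : RankFn → Subset n → Subset n → Subset n → Set₁
  GenCut f F₁ F₂ X =
    (𝓜 : Collection) → IsModularCut f 𝓜 → 𝓜 F₁ → 𝓜 F₂ → 𝓜 X

  -- d = δ(𝓜): d is the minimum of δ(G₁,G₂) over pairs G₁,G₂ ∈ 𝓜 with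
  -- G₁ ∩ G₂ ∉ 𝓜 (the minimum is attained and is a lower bound)
  record IsCutDefect {ℓ} (f : RankFn) (𝓜 : Subset n → Set ℓ) (d : Carrier) : Set ℓ where
    field
      attained : Σ[ G₁ ∈ Subset n ] Σ[ G₂ ∈ Subset n ]
                   (𝓜 G₁ × 𝓜 G₂ × ¬ 𝓜 (G₁ ∩ G₂) × defect f G₁ G₂ ≡ d)
      lower    : ∀ G₁ G₂ → 𝓜 G₁ → 𝓜 G₂ → ¬ 𝓜 (G₁ ∩ G₂) → d ≤ defect f G₁ G₂

-- Flats containing S = F₁ ∩ F₂ form a modular cut (intersections of flats
-- are flats), so every F ∈ 𝓜 contains S.  For G, H ∈ 𝓜 with G ∩ H ∉ 𝓜,
-- minimality of δ gives δ ≤ δ(G,H) < f(G) - f(S), since f(G ∪ H) > f(H) by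
-- flatness of H and f(G ∩ H) ≥ f(S).  If F ∩ F₁ ∉ 𝓜, take (G,H) = (F,F₁);
-- otherwise K = F ∩ F₁ ∈ 𝓜 and K ∩ F₂ = S ∉ 𝓜, so take (K,F₂) and use
-- f(K) ≤ f(F).
module Submission where

open import Defs
open import Level using (0ℓ)
open import Function using (_∘_)
open import Data.Nat using (ℕ)
open import Data.Product using (_×_; _,_; proj₁; proj₂)
open import Data.Sum using (inj₁; inj₂)
open import Data.Empty using (⊥-elim)
open import Data.Fin.Subset using (Subset; _⊆_; _∩_; _∪_)
open import Data.Fin.Subset.Properties
  using (⊆-antisym; ⊆-trans; _⊆?_; p∩q⊆p; p∩q⊆q; x∈p∩q⁺; p⊆p∪q; q⊆p∪q; ∩-assoc; ∩-comm; ∪-comm)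
open import Relation.Nullary using (¬_; yes; no)
open import Relation.Binary.PropositionalEquality
  using (_≡_; _≢_; sym; trans; cong; subst; subst₂; module ≡-Reasoning)
open import Relation.Binary.Structures using (IsTotalOrder)
open import Algebra.Bundles using (AbelianGroup)
import Algebra.Properties.AbelianGroup as AbelianGroupProperties
import Algebra.Properties.CommutativeSemigroup as CommutativeSemigroupProperties

module _ {n : ℕ} where

  ⊆⇒∩≡ : {A B : Subset n} → A ⊆ B → A ∩ B ≡ A
  ⊆⇒∩≡ {A} {B} A⊆B = ⊆-antisym (p∩q⊆p A B) (λ x∈A → x∈p∩q⁺ (x∈A , A⊆B x∈A))

  ⊆-∩ : {A B C : Subset n} → A ⊆ B → A ⊆ C → A ⊆ B ∩ C
  ⊆-∩ A⊆B A⊆C x∈A = x∈p∩q⁺ (A⊆B x∈A , A⊆C x∈A)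

  ¬⊆⇒≢∪ : {A B : Subset n} → ¬ B ⊆ A → A ≢ A ∪ B
  ¬⊆⇒≢∪ {A} {B} B⊈A A≡A∪B = B⊈A (subst (B ⊆_) (sym A≡A∪B) (q⊆p∪q A B))

module OrderedAbelianGroupProperties (R : OrderedAbelianGroup) where
  open OrderedAbelianGroup R
  open IsTotalOrder isTotalOrder using (antisym; total) renaming (refl to ≤-refl; trans to ≤-trans)

  abelianGroup : AbelianGroup 0ℓ 0ℓ
  abelianGroup = record { isAbelianGroup = isAbelianGroup }

  open AbelianGroup abelianGroup using (comm; assoc; identityʳ; inverseʳ; commutativeSemigroup)
  open AbelianGroupProperties abelianGroup using (∙-cancelʳ; \\-leftDividesˡ; \\-leftDividesʳ)
  open CommutativeSemigroupProperties commutativeSemigroup using (interchange)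

  ≤-<-trans : ∀ {a b c} → a ≤ b → b < c → a < c
  ≤-<-trans a≤b (b≤c , b≢c) = ≤-trans a≤b b≤c , λ a≡c → b≢c (antisym b≤c (subst (_≤ _) a≡c a≤b))

  <-≤-trans : ∀ {a b c} → a < b → b ≤ c → a < c
  <-≤-trans (a≤b , a≢b) b≤c = ≤-trans a≤b b≤c , λ a≡c → a≢b (antisym a≤b (subst (_ ≤_) (sym a≡c) b≤c))

  <-stable : ∀ {a b} → ¬ ¬ (a < b) → a < b
  <-stable {a} {b} ¬¬a<b with total a b
  ... | inj₁ a≤b = a≤b , λ a≡b → ¬¬a<b (λ a<b → proj₂ a<b a≡b)
  ... | inj₂ b≤a = ⊥-elim (¬¬a<b (λ a<b → proj₂ a<b (antisym (proj₁ a<b) b≤a)))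

  +-monoʳ-≤ : ∀ {a b} c → a ≤ b → c + a ≤ c + b
  +-monoʳ-≤ {a} {b} c a≤b = subst₂ _≤_ (comm a c) (comm b c) (+-monoˡ-≤ c a≤b)

  +-mono-≤ : ∀ {a b c d} → a ≤ b → c ≤ d → a + c ≤ b + d
  +-mono-≤ {b = b} {c} a≤b c≤d = ≤-trans (+-monoˡ-≤ c a≤b) (+-monoʳ-≤ b c≤d)

  +-mono-<-≤ : ∀ {a b c d} → a < b → c ≤ d → a + c < b + d
  +-mono-<-≤ {a} {b} {c} {d} (a≤b , a≢b) c≤d =
    +-mono-≤ a≤b c≤d , λ a+c≡b+d → a≢b (∙-cancelʳ c a b (antisym (+-monoˡ-≤ c a≤b)
      (subst (b + c ≤_) (sym a+c≡b+d) (+-monoʳ-≤ b c≤d))))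

  +-mono-≤-< : ∀ {a b c d} → a ≤ b → c < d → a + c < b + d
  +-mono-≤-< {a} {b} {c} {d} a≤b c<d = subst₂ _<_ (comm c a) (comm d b) (+-mono-<-≤ c<d a≤b)

  +-cancelˡ-< : ∀ {a b} c → c + a < c + b → a < b
  +-cancelˡ-< {a} {b} c (c+a≤c+b , c+a≢c+b) =
    subst₂ _≤_ (\\-leftDividesʳ c a) (\\-leftDividesʳ c b) (+-monoʳ-≤ (- c) c+a≤c+b) ,
    c+a≢c+b ∘ cong (c +_)

  neg-antitone-≤ : ∀ {a b} → a ≤ b → - b ≤ - a
  neg-antitone-≤ {a} {b} a≤b = subst₂ _≤_ (\\-leftDividesˡ a (- b)) b+[-a+-b]≡-a (+-monoˡ-≤ (- a + - b) a≤b)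
    where
    b+[-a+-b]≡-a : b + (- a + - b) ≡ - a
    b+[-a+-b]≡-a = trans (cong (b +_) (comm (- a) (- b))) (\\-leftDividesˡ b (- a))

  x<y⇒x-y<0 : ∀ {x y} → x < y → x - y < 0#
  x<y⇒x-y<0 {x} {y} x<y = subst (x - y <_) (inverseʳ y) (+-mono-<-≤ x<y (≤-refl { - y}))

  a+b-c-e<a-s : ∀ {a b c e s} → b < e → s ≤ c → a + b - c - e < a - s
  a+b-c-e<a-s {a} {b} {c} {e} {s} b<e s≤c = subst₂ _<_ (sym regroup) (identityʳ (a - s))
    (+-mono-≤-< (+-monoʳ-≤ a (neg-antitone-≤ s≤c)) (x<y⇒x-y<0 b<e))
    where
    regroup : a + b - c - e ≡ (a - c) + (b - e)
    regroup = trans (assoc (a + b) (- c) (- e)) (interchange a b (- c) (- e))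

module PolymatroidProperties (R : OrderedAbelianGroup) {n : ℕ}
  {f : Subset n → OrderedAbelianGroup.Carrier R} (polymatroid : IsPolymatroid R f) where
  open OrderedAbelianGroup R
  open OrderedAbelianGroupProperties R
  open IsPolymatroid polymatroid
  open IsTotalOrder isTotalOrder using () renaming (refl to ≤-refl)

  flat-<-∪ : ∀ {F G} → IsFlat R f F → ¬ G ⊆ F → f F < f (F ∪ G)
  flat-<-∪ {F} {G} F-flat G⊈F = F-flat (F ∪ G) (p⊆p∪q G) (¬⊆⇒≢∪ G⊈F)

  flat-∩-< : ∀ {F G} → IsFlat R f F → ¬ G ⊆ F → f (F ∩ G) < f G
  flat-∩-< {F} {G} F-flat G⊈F =
    +-cancelˡ-< (f F) (<-≤-trans (+-mono-<-≤ (flat-<-∪ F-flat G⊈F) ≤-refl) (submodular F G))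

  flat-∩ : ∀ {F G} → IsFlat R f F → IsFlat R f G → IsFlat R f (F ∩ G)
  flat-∩ {F} {G} F-flat G-flat H F∩G⊆H F∩G≢H with H ⊆? F | H ⊆? G
  ... | yes H⊆F | yes H⊆G = ⊥-elim (F∩G≢H (⊆-antisym F∩G⊆H (⊆-∩ H⊆F H⊆G)))
  ... | no H⊈F  | _       =
    ≤-<-trans (monotone (⊆-∩ (p∩q⊆p F G) F∩G⊆H)) (flat-∩-< F-flat H⊈F)
  ... | yes _   | no H⊈G  =
    ≤-<-trans (monotone (⊆-∩ (p∩q⊆q F G) F∩G⊆H)) (flat-∩-< G-flat H⊈G)

  flats-⊇-isModularCut : ∀ T → IsModularCut R f (λ F → IsFlat R f F × T ⊆ F)
  flats-⊇-isModularCut T = record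
    { flats   = λ _ → proj₁
    ; upward  = λ _ _ (_ , T⊆F) G-flat F⊆G → G-flat , ⊆-trans T⊆F F⊆G
    ; modular = λ _ _ (F-flat , T⊆F) (G-flat , T⊆G) _ → flat-∩ F-flat G-flat , ⊆-∩ T⊆F T⊆G
    }

  defect-<-flat : ∀ {G H T} → IsFlat R f H → ¬ G ⊆ H → T ⊆ G ∩ H → defect R f G H < f G - f T
  defect-<-flat {G} {H} H-flat G⊈H T⊆G∩H =
    a+b-c-e<a-s (subst (λ X → f H < f X) (∪-comm H G) (flat-<-∪ H-flat G⊈H)) (monotone T⊆G∩H)

module GeneratedCut (R : OrderedAbelianGroup) {n : ℕ}
  {f : Subset n → OrderedAbelianGroup.Carrier R} (polymatroid : IsPolymatroid R f)
  (F₁ F₂ : Subset n) where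
  open OrderedAbelianGroup R
  open OrderedAbelianGroupProperties R
  open PolymatroidProperties R polymatroid
  open IsPolymatroid polymatroid using (monotone)

  𝓜 : Subset n → Set₁
  𝓜 = GenCut R f F₁ F₂

  S : Subset n
  S = F₁ ∩ F₂

  δ : Carrier
  δ = defect R f F₁ F₂

  F₁∈𝓜 : 𝓜 F₁
  F₁∈𝓜 _ _ F₁∈𝓝 _ = F₁∈𝓝

  F₂∈𝓜 : 𝓜 F₂
  F₂∈𝓜 _ _ _ F₂∈𝓝 = F₂∈𝓝

  module _ (F₁-flat : IsFlat R f F₁) (F₂-flat : IsFlat R f F₂) where

    𝓜-flat-⊇ : ∀ {F} → 𝓜 F → IsFlat R f F × S ⊆ F
    𝓜-flat-⊇ F∈𝓜 =
      F∈𝓜 _ (flats-⊇-isModularCut S) (F₁-flat , p∩q⊆p F₁ F₂) (F₂-flat , p∩q⊆q F₁ F₂)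

    module _ (isCutDefect : IsCutDefect R f 𝓜 δ) where
      open IsCutDefect isCutDefect using (lower)

      δ-<-rank-gap-pair : ∀ {G H} → 𝓜 G → 𝓜 H → ¬ 𝓜 (G ∩ H) → δ < f G - f S
      δ-<-rank-gap-pair {G} {H} G∈𝓜 H∈𝓜 G∩H∉𝓜 =
        ≤-<-trans (lower G H G∈𝓜 H∈𝓜 G∩H∉𝓜) (defect-<-flat H-flat G⊈H (⊆-∩ S⊆G S⊆H))
        where
        G⊈H : ¬ G ⊆ H
        G⊈H G⊆H = G∩H∉𝓜 (subst 𝓜 (sym (⊆⇒∩≡ G⊆H)) G∈𝓜)
        S⊆G : S ⊆ G
        S⊆G = proj₂ (𝓜-flat-⊇ G∈𝓜)
        H-flat : IsFlat R f H
        H-flat = proj₁ (𝓜-flat-⊇ H∈𝓜)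
        S⊆H : S ⊆ H
        S⊆H = proj₂ (𝓜-flat-⊇ H∈𝓜)

      -- Membership of F ∩ F₁ in 𝓜 is not decidable, but _<_ is ¬¬-stable.
      δ-<-rank-gap : ¬ 𝓜 S → ∀ {F} → 𝓜 F → δ < f F - f S
      δ-<-rank-gap S∉𝓜 {F} F∈𝓜 = <-stable λ ¬goal →
        ¬goal (δ-<-rank-gap-pair F∈𝓜 F₁∈𝓜 λ F∩F₁∈𝓜 → ¬goal (via-F∩F₁ F∩F₁∈𝓜))
        where
        [F∩F₁]∩F₂≡S : (F ∩ F₁) ∩ F₂ ≡ S
        [F∩F₁]∩F₂≡S = begin
          (F ∩ F₁) ∩ F₂ ≡⟨ ∩-assoc F F₁ F₂ ⟩
          F ∩ S         ≡⟨ ∩-comm F S ⟩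
          S ∩ F         ≡⟨ ⊆⇒∩≡ (proj₂ (𝓜-flat-⊇ F∈𝓜)) ⟩
          S             ∎
          where open ≡-Reasoning

        via-F∩F₁ : 𝓜 (F ∩ F₁) → δ < f F - f S
        via-F∩F₁ F∩F₁∈𝓜 =
          <-≤-trans (δ-<-rank-gap-pair F∩F₁∈𝓜 F₂∈𝓜 (S∉𝓜 ∘ subst 𝓜 [F∩F₁]∩F₂≡S))
                    (+-monoˡ-≤ (- f S) (monotone (p∩q⊆p F F₁)))

lemma1 : (R : OrderedAbelianGroup) {n : ℕ} (f : Subset n → OrderedAbelianGroup.Carrier R)
    → IsPolymatroid R f
    → (F₁ F₂ : Subset n) → IsFlat R f F₁ → IsFlat R f F₂
    → ¬ GenCut R f F₁ F₂ (F₁ ∩ F₂)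
    → IsCutDefect R f (GenCut R f F₁ F₂) (defect R f F₁ F₂)
    → ∀ F → GenCut R f F₁ F₂ F
    → (F₁ ∩ F₂ ⊆ F) × OrderedAbelianGroup._<_ R (defect R f F₁ F₂) (OrderedAbelianGroup._-_ R (f F) (f (F₁ ∩ F₂)))
lemma1 R f polymatroid F₁ F₂ F₁-flat F₂-flat S∉𝓜 isCutDefect F F∈𝓜 =
  proj₂ (𝓜-flat-⊇ F₁-flat F₂-flat F∈𝓜) , δ-<-rank-gap F₁-flat F₂-flat isCutDefect S∉𝓜 F∈𝓜
  where open GeneratedCut R polymatroid F₁ F₂
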